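{- Let $P = (B; s, t; \alpha, \beta)$ be a subsequence. Then, as a word, $\rho P$ is either the reverse of $P$ or the dual of $P$ (the reverse of $P$ with the letters $0$ and $1$ interchanged).
   Context: For $\epsilon \in \{0,1\}$, $W_\epsilon^\ell$ is the alternating word of length $\ell$ starting with $\epsilon$. A block decomposition $B = (\epsilon_1; \ell_1, \ldots, \ell_n)$ has word $W_{\epsilon_1}^{\ell_1}\cdots W_{\epsilon_n}^{\ell_n}$, $\epsilon_{i+1} \equiv \epsilon_i + \ell_i - 1 \pmod 2$. A subsequence of $\mathrm{word}(B)$ is a contiguous substring of length at least $2$, encoded as $P = (B; s, t; \alpha, \beta)$: it starts in block $s$ after $\alpha$ letters of that block and ends in block $t$ with $\beta$ letters of that block after it ($s \le t$, $0 \le \alpha < \ell_s$, $0 \le \beta < \ell_t$, and $\alpha + \beta + 2 \le \ell_s$ if $s=t$). The reflection $\rho_{s,t}$ reverses $\ell_s, \ldots, \ell_t$ keeping $\epsilon_1$ and the other lengths; $\rho P := (\rho_{s,t}B; s, t; \beta, \alpha)$, a subsequence of $\mathrm{word}(\rho_{s,t}B)$. -}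

module Defs where

open import Data.Bool using (Bool; true; false; not)
open import Data.Nat using (ℕ; zero; suc; _+_; _∸_; _≤_; _<_)
open import Data.List using (List; []; _∷_; _++_; take; drop; reverse; map; length)
open import Data.Nat.ListAction using (sum)
open import Relation.Binary.PropositionalEquality using (_≡_)
open import Data.List.Relation.Unary.All using (All)
open import Data.Product using (_×_)

-- Letters 0 and 1 are represented by false and true.
Letter : Set
Letter = Bool

alt : Letter → ℕ → List Letter
alt ε zero    = []
alt ε (suc ℓ) = ε ∷ alt (not ε) ℓ

-- Next block's starting letter: ε_{i+1} ≡ ε_i + ℓ_i − 1 (mod 2).
-- Flipping ε exactly (ℓ − 1) times.
flipN : ℕ → Letter → Letter
flipN zero    ε = ε
flipN (suc n) ε = not (flipN n ε)

nextStart : Letter → ℕ → Letter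
nextStart ε ℓ = flipN (ℓ ∸ 1) ε

record BlockDec : Set where
  constructor bd
  field
    eps     : Letter
    lengths : List ℕ
open BlockDec public

WellFormed : BlockDec → Set
WellFormed B = All (λ ℓ → 1 ≤ ℓ) (lengths B)

wordFrom : Letter → List ℕ → List Letter
wordFrom ε []       = []
wordFrom ε (ℓ ∷ ls) = alt ε ℓ ++ wordFrom (nextStart ε ℓ) ls

word : BlockDec → List Letter
word B = wordFrom (eps B) (lengths B)

-- Block lengths are indexed from 0 here (block i of the paper is index i−1).
len : List ℕ → ℕ → ℕ
len []       _       = 0
len (ℓ ∷ ls) zero    = ℓ
len (ℓ ∷ ls) (suc i) = len ls i

record Subseq : Set where
  constructor subseq
  field
    blocks : BlockDec
    s t    : ℕ
    α β    : ℕ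
open Subseq public

IsSubseq : Subseq → Set
IsSubseq P =
  WellFormed (blocks P) ×
  s P ≤ t P ×
  t P < length (lengths (blocks P)) ×
  α P < len (lengths (blocks P)) (s P) ×
  β P < len (lengths (blocks P)) (t P) ×
  (s P ≡ t P → α P + β P + 2 ≤ len (lengths (blocks P)) (s P))

subword : Subseq → List Letter
subword P = take (stop ∸ start) (drop start (word (blocks P)))
  where
  ls    = lengths (blocks P)
  start = sum (take (s P) ls) + α P
  stop  = sum (take (suc (t P)) ls) ∸ β P

reflectLengths : ℕ → ℕ → List ℕ → List ℕ
reflectLengths s t ls =
  take s ls ++ reverse (take (suc t ∸ s) (drop s ls)) ++ drop (suc t) ls

ρB : ℕ → ℕ → BlockDec → BlockDec
ρB s t B = bd (eps B) (reflectLengths s t (lengths B))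

ρ : Subseq → Subseq
ρ P = subseq (ρB (s P) (t P) (blocks P)) (s P) (t P) (β P) (α P)

dual : List Letter → List Letter
dual w = map not (reverse w)

module Submission where

-- Split the block lengths of B as A ++ M ++ C, where M = (ℓ_s, …, ℓ_t) are the
-- blocks met by P; ρ_{s,t} B has lengths A ++ reverse M ++ C.  Both subwords are
-- "windows" of the word X of the middle blocks: P is X with α letters trimmed
-- in front and β behind, while ρP is the word X' of reverse M with β letters
-- trimmed in front and α behind (the prefix A contributes the same letters to
-- both words, so X and X' start with the same letter e₁).
--
-- The theorem then transports "reverse or dual" from X', X to the windows.

open import Defs
open import Data.List using (reverse)
open import Data.Sum using (_⊎_)
open import Relation.Binary.PropositionalEquality using (_≡_)

open import Data.Bool using (not)
open import Data.Bool.Properties using (not-involutive; ¬-not) renaming (_≟_ to _≟ᴮ_)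
open import Data.Nat using (ℕ; zero; suc; _+_; _∸_; _≤_; s≤s)
open import Data.Nat.Properties
open import Data.Nat.ListAction using (sum)
open import Data.Nat.ListAction.Properties using (sum-++)
open import Data.List using (List; []; _∷_; _++_; take; drop; map; length; [_])
open import Data.List.Properties
  using (take-[]; length-take; take-map; drop-map; take++drop≡id; length-drop; length-map; length-++;
         length-reverse; reverse-++; unfold-reverse; map-++; ++-assoc; ++-identityʳ)
open import Data.Product using (_,_)
open import Data.Sum using (inj₁; inj₂)
open import Relation.Binary.PropositionalEquality
  using (refl; sym; trans; cong; cong₂; subst; subst₂; module ≡-Reasoning)
open import Relation.Nullary using (yes; no)
open ≡-Reasoning

private
  variable
    T T′ : Set

take-length-++ : (u v : List T) → take (length u) (u ++ v) ≡ u
take-length-++ []      v = refl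
take-length-++ (x ∷ u) v = cong (x ∷_) (take-length-++ u v)

drop-length-++ : (u v : List T) (n : ℕ) → drop (length u + n) (u ++ v) ≡ drop n v
drop-length-++ []      v n = refl
drop-length-++ (x ∷ u) v n = drop-length-++ u v n

take-drop-++ˡ : (w v : List T) (a k : ℕ) → k ≤ length w ∸ a →
                take k (drop a (w ++ v)) ≡ take k (drop a w)
take-drop-++ˡ w       v zero    zero    _       = refl
take-drop-++ˡ []      v zero    (suc k) ()
take-drop-++ˡ (x ∷ w) v zero    (suc k) (s≤s p) = cong (x ∷_) (take-drop-++ˡ w v zero k p)
take-drop-++ˡ []      v (suc a) zero    _       = refl
take-drop-++ˡ []      v (suc a) (suc k) ()
take-drop-++ˡ (x ∷ w) v (suc a) k       p       = take-drop-++ˡ w v a k p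

take-+ : (m k : ℕ) (w : List T) → take (m + k) w ≡ take m w ++ take k (drop m w)
take-+ zero    k w       = refl
take-+ (suc m) k []      = sym (take-[] k)
take-+ (suc m) k (x ∷ w) = cong (x ∷_) (take-+ m k w)

length-take-≤ : (m : ℕ) (w : List T) → m ≤ length w → length (take m w) ≡ m
length-take-≤ m w m≤ = trans (length-take m w) (m≤n⇒m⊓n≡m m≤)

seg : ℕ → ℕ → List T → List T
seg a b w = take (length w ∸ a ∸ b) (drop a w)

seg-++ˡ : (a b : ℕ) (w v : List T) →
          take (length w ∸ a ∸ b) (drop a (w ++ v)) ≡ seg a b w
seg-++ˡ a b w v = take-drop-++ˡ w v a _ (m∸n≤m (length w ∸ a) b)

seg-middle : (A M C : List T) → seg (length A) (length C) (A ++ M ++ C) ≡ M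
seg-middle A M C = begin
  take (length (A ++ M ++ C) ∸ length A ∸ length C) (drop (length A) (A ++ M ++ C))
    ≡⟨ cong₂ take count (trans (cong (λ k → drop k (A ++ M ++ C)) (sym (+-identityʳ (length A))))
                               (drop-length-++ A (M ++ C) 0)) ⟩
  take (length M) (M ++ C)
    ≡⟨ take-length-++ M C ⟩
  M ∎
  where
  a = length A
  m = length M
  c = length C
  count : length (A ++ M ++ C) ∸ a ∸ c ≡ m
  count = begin
    length (A ++ M ++ C) ∸ a ∸ c ≡⟨ cong (λ n → n ∸ a ∸ c) (trans (length-++ A) (cong (a +_) (length-++ M))) ⟩
    a + (m + c) ∸ a ∸ c          ≡⟨ cong (_∸ c) (m+n∸m≡n a (m + c)) ⟩
    m + c ∸ c                    ≡⟨ m+n∸n≡m m c ⟩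
    m ∎

data Trim {T : Set} : ℕ → ℕ → List T → Set where
  trim : (A M C : List T) → Trim (length A) (length C) (A ++ M ++ C)

trim-view : (a b : ℕ) (w : List T) → a + b ≤ length w → Trim a b w
trim-view a b w a+b≤n =
  subst₂ (λ x y → Trim x y w) length-front length-back
    (subst (Trim _ _) (sym decomposition) (trim front middle back))
  where
  n      = length w
  k      = n ∸ a ∸ b
  front  = take a w
  middle = take k (drop a w)
  back   = drop k (drop a w)
  decomposition : w ≡ front ++ middle ++ back
  decomposition = sym (trans (cong (front ++_) (take++drop≡id k (drop a w))) (take++drop≡id a w))
  b≤n∸a : b ≤ n ∸ a
  b≤n∸a = subst (_≤ n ∸ a) (m+n∸m≡n a b) (∸-monoˡ-≤ a a+b≤n)
  length-front : length front ≡ a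
  length-front = length-take-≤ a w (≤-trans (m≤m+n a b) a+b≤n)
  length-back : length back ≡ b
  length-back = trans (length-drop k (drop a w))
                      (trans (cong (_∸ k) (length-drop a w)) (m∸[m∸n]≡n b≤n∸a))

-- Reversal swaps the outer parts, so trimming them from the reverse gives reverse M.
seg-reverse-trim : {a b : ℕ} {w : List T} → Trim a b w → seg b a (reverse w) ≡ reverse (seg a b w)
seg-reverse-trim (trim A M C) = begin
  seg (length C) (length A) (reverse (A ++ M ++ C))
    ≡⟨ cong (seg (length C) (length A)) reversed ⟩
  seg (length C) (length A) (reverse C ++ reverse M ++ reverse A)
    ≡⟨ cong₂ (λ c a → seg c a (reverse C ++ reverse M ++ reverse A))
             (sym (length-reverse C)) (sym (length-reverse A)) ⟩
  seg (length (reverse C)) (length (reverse A)) (reverse C ++ reverse M ++ reverse A)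
    ≡⟨ seg-middle (reverse C) (reverse M) (reverse A) ⟩
  reverse M
    ≡⟨ cong reverse (seg-middle A M C) ⟨
  reverse (seg (length A) (length C) (A ++ M ++ C)) ∎
  where
  reversed : reverse (A ++ M ++ C) ≡ reverse C ++ reverse M ++ reverse A
  reversed = begin
    reverse (A ++ M ++ C)                ≡⟨ reverse-++ A (M ++ C) ⟩
    reverse (M ++ C) ++ reverse A         ≡⟨ cong (_++ reverse A) (reverse-++ M C) ⟩
    (reverse C ++ reverse M) ++ reverse A ≡⟨ ++-assoc (reverse C) (reverse M) (reverse A) ⟩
    reverse C ++ reverse M ++ reverse A   ∎

-- Trimming commutes with reversal, the trim amounts trading places.
-- If a + b exceeds the length, both sides are empty.
seg-reverse : (a b : ℕ) (w : List T) → seg b a (reverse w) ≡ reverse (seg a b w)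
seg-reverse a b w with a + b ≤? length w
... | yes a+b≤n = seg-reverse-trim (trim-view a b w a+b≤n)
... | no  a+b≰n = begin
  take (length (reverse w) ∸ b ∸ a) (drop b (reverse w)) ≡⟨ cong (λ k → take k (drop b (reverse w))) empty-rev ⟩
  []                                                    ≡⟨ cong (λ k → reverse (take k (drop a w))) empty ⟨
  reverse (take (length w ∸ a ∸ b) (drop a w))           ∎
  where
  n≤a+b : length w ≤ a + b
  n≤a+b = <⇒≤ (≰⇒> a+b≰n)
  empty : length w ∸ a ∸ b ≡ 0
  empty = trans (∸-+-assoc (length w) a b) (m≤n⇒m∸n≡0 n≤a+b)
  empty-rev : length (reverse w) ∸ b ∸ a ≡ 0
  empty-rev = trans (cong (λ n → n ∸ b ∸ a) (length-reverse w))
                    (trans (∸-+-assoc (length w) b a) (m≤n⇒m∸n≡0 (subst (length w ≤_) (+-comm a b) n≤a+b)))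

seg-map : (f : T → T′) (a b : ℕ) (w : List T) → seg a b (map f w) ≡ map f (seg a b w)
seg-map f a b w = begin
  take (length (map f w) ∸ a ∸ b) (drop a (map f w))
    ≡⟨ cong₂ (λ n v → take (n ∸ a ∸ b) v) (length-map f w) (drop-map a w) ⟩
  take (length w ∸ a ∸ b) (map f (drop a w))
    ≡⟨ take-map (length w ∸ a ∸ b) (drop a w) ⟩
  map f (seg a b w) ∎

ReverseOrDual : List Letter → List Letter → Set
ReverseOrDual u v = (u ≡ reverse v) ⊎ (u ≡ dual v)

seg-reverseOrDual : (a b : ℕ) {u v : List Letter} →
                    ReverseOrDual u v → ReverseOrDual (seg b a u) (seg a b v)
seg-reverseOrDual a b {v = v} (inj₁ refl) = inj₁ (seg-reverse a b v)
seg-reverseOrDual a b {v = v} (inj₂ refl) = inj₂ (begin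
  seg b a (map not (reverse v)) ≡⟨ seg-map not b a (reverse v) ⟩
  map not (seg b a (reverse v)) ≡⟨ cong (map not) (seg-reverse a b v) ⟩
  dual (seg a b v)              ∎)

flipN-not : (n : ℕ) (e : Letter) → flipN n (not e) ≡ not (flipN n e)
flipN-not zero    e = refl
flipN-not (suc n) e = cong not (flipN-not n e)

flipN-flipN : (n : ℕ) (e : Letter) → flipN n (flipN n e) ≡ e
flipN-flipN zero    e = refl
flipN-flipN (suc n) e = begin
  not (flipN n (not (flipN n e))) ≡⟨ cong not (flipN-not n (flipN n e)) ⟩
  not (not (flipN n (flipN n e))) ≡⟨ not-involutive _ ⟩
  flipN n (flipN n e)             ≡⟨ flipN-flipN n e ⟩
  e                               ∎

alt-snoc : (e : Letter) (ℓ : ℕ) → alt e (suc ℓ) ≡ alt e ℓ ++ [ flipN ℓ e ]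
alt-snoc e zero    = refl
alt-snoc e (suc ℓ) = cong (e ∷_)
  (trans (alt-snoc (not e) ℓ) (cong (λ x → alt (not e) ℓ ++ [ x ]) (flipN-not ℓ e)))

-- A reversed block is the alternating word starting at the block's last letter.
alt-reverse : (e : Letter) (ℓ : ℕ) → reverse (alt e ℓ) ≡ alt (nextStart e ℓ) ℓ
alt-reverse e zero          = refl
alt-reverse e (suc zero)    = refl
alt-reverse e (suc (suc k)) = begin
  reverse (e ∷ alt (not e) (suc k))       ≡⟨ unfold-reverse e (alt (not e) (suc k)) ⟩
  reverse (alt (not e) (suc k)) ++ [ e ]  ≡⟨ cong (_++ [ e ]) (alt-reverse (not e) (suc k)) ⟩
  alt (flipN k (not e)) (suc k) ++ [ e ]  ≡⟨ cong₂ (λ x y → alt x (suc k) ++ [ y ])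
                                                   (flipN-not k e) (sym (flipN-flipN (suc k) e)) ⟩
  alt last (suc k) ++ [ flipN (suc k) last ] ≡⟨ alt-snoc last (suc k) ⟨
  alt last (suc (suc k))                  ∎
  where
  last = flipN (suc k) e

alt-not : (e : Letter) (ℓ : ℕ) → alt (not e) ℓ ≡ map not (alt e ℓ)
alt-not e zero    = refl
alt-not e (suc ℓ) = cong (not e ∷_) (alt-not (not e) ℓ)

length-alt : (e : Letter) (ℓ : ℕ) → length (alt e ℓ) ≡ ℓ
length-alt e zero    = refl
length-alt e (suc ℓ) = cong suc (length-alt (not e) ℓ)

-- The starting letter of the block following the blocks ls; for non-empty
-- blocks this is also the last letter of wordFrom e ls.
startAfter : Letter → List ℕ → Letter
startAfter e []       = e
startAfter e (ℓ ∷ ls) = startAfter (nextStart e ℓ) ls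

startAfter-++ : (e : Letter) (ks ls : List ℕ) →
                startAfter e (ks ++ ls) ≡ startAfter (startAfter e ks) ls
startAfter-++ e []       ls = refl
startAfter-++ e (k ∷ ks) ls = startAfter-++ (nextStart e k) ks ls

wordFrom-++ : (e : Letter) (ks ls : List ℕ) →
              wordFrom e (ks ++ ls) ≡ wordFrom e ks ++ wordFrom (startAfter e ks) ls
wordFrom-++ e []       ls = refl
wordFrom-++ e (k ∷ ks) ls = trans (cong (alt e k ++_) (wordFrom-++ (nextStart e k) ks ls))
                                  (sym (++-assoc (alt e k) _ _))

startAfter-reverse : (e : Letter) (ls : List ℕ) → startAfter (startAfter e ls) (reverse ls) ≡ e
startAfter-reverse e []       = refl
startAfter-reverse e (ℓ ∷ ls) = begin
  startAfter end (reverse (ℓ ∷ ls))        ≡⟨ cong (startAfter end) (unfold-reverse ℓ ls) ⟩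
  startAfter end (reverse ls ++ [ ℓ ])     ≡⟨ startAfter-++ end (reverse ls) [ ℓ ] ⟩
  nextStart (startAfter end (reverse ls)) ℓ ≡⟨ cong (λ x → nextStart x ℓ) (startAfter-reverse (nextStart e ℓ) ls) ⟩
  nextStart (nextStart e ℓ) ℓ              ≡⟨ flipN-flipN (ℓ ∸ 1) e ⟩
  e                                        ∎
  where
  end = startAfter (nextStart e ℓ) ls

wordFrom-reverse : (e : Letter) (ls : List ℕ) →
                   reverse (wordFrom e ls) ≡ wordFrom (startAfter e ls) (reverse ls)
wordFrom-reverse e []       = refl
wordFrom-reverse e (ℓ ∷ ls) = begin
  reverse (alt e ℓ ++ wordFrom e′ ls)
    ≡⟨ reverse-++ (alt e ℓ) _ ⟩
  reverse (wordFrom e′ ls) ++ reverse (alt e ℓ)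
    ≡⟨ cong₂ _++_ (wordFrom-reverse e′ ls) (alt-reverse e ℓ) ⟩
  wordFrom end (reverse ls) ++ alt e′ ℓ
    ≡⟨ cong (wordFrom end (reverse ls) ++_) lastBlock ⟨
  wordFrom end (reverse ls) ++ wordFrom (startAfter end (reverse ls)) [ ℓ ]
    ≡⟨ wordFrom-++ end (reverse ls) [ ℓ ] ⟨
  wordFrom end (reverse ls ++ [ ℓ ])
    ≡⟨ cong (wordFrom end) (unfold-reverse ℓ ls) ⟨
  wordFrom end (reverse (ℓ ∷ ls)) ∎
  where
  e′  = nextStart e ℓ
  end = startAfter e′ ls
  lastBlock : wordFrom (startAfter end (reverse ls)) [ ℓ ] ≡ alt e′ ℓ
  lastBlock = trans (++-identityʳ _) (cong (λ x → alt x ℓ) (startAfter-reverse e′ ls))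

wordFrom-not : (e : Letter) (ls : List ℕ) → wordFrom (not e) ls ≡ map not (wordFrom e ls)
wordFrom-not e []       = refl
wordFrom-not e (ℓ ∷ ls) = begin
  alt (not e) ℓ ++ wordFrom (flipN (ℓ ∸ 1) (not e)) ls
    ≡⟨ cong₂ _++_ (alt-not e ℓ)
                  (trans (cong (λ x → wordFrom x ls) (flipN-not (ℓ ∸ 1) e))
                         (wordFrom-not (nextStart e ℓ) ls)) ⟩
  map not (alt e ℓ) ++ map not (wordFrom (nextStart e ℓ) ls)
    ≡⟨ map-++ not (alt e ℓ) _ ⟨
  map not (wordFrom e (ℓ ∷ ls)) ∎

length-wordFrom : (e : Letter) (ls : List ℕ) → length (wordFrom e ls) ≡ sum ls
length-wordFrom e []       = refl
length-wordFrom e (ℓ ∷ ls) =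
  trans (length-++ (alt e ℓ)) (cong₂ _+_ (length-alt e ℓ) (length-wordFrom _ ls))

-- Key fact: keeping the start letter and reversing the block lengths gives
-- the reverse word if the word ends where it started, and its dual otherwise.
blocks-reversed : (e : Letter) (ls : List ℕ) → ReverseOrDual (wordFrom e (reverse ls)) (wordFrom e ls)
blocks-reversed e ls with startAfter e ls ≟ᴮ e
... | yes end≡e = inj₁ (sym (trans (wordFrom-reverse e ls) (cong (λ x → wordFrom x (reverse ls)) end≡e)))
... | no  end≢e = inj₂ (begin
  wordFrom e (reverse ls)
    ≡⟨ cong (λ x → wordFrom x (reverse ls)) e≡not-end ⟩
  wordFrom (not (startAfter e ls)) (reverse ls)
    ≡⟨ wordFrom-not (startAfter e ls) (reverse ls) ⟩
  map not (wordFrom (startAfter e ls) (reverse ls))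
    ≡⟨ cong (map not) (wordFrom-reverse e ls) ⟨
  dual (wordFrom e ls) ∎)
  where
  e≡not-end : e ≡ not (startAfter e ls)
  e≡not-end = ¬-not (λ e≡end → end≢e (sym e≡end))

window : (e : Letter) (A M C : List ℕ) (α β : ℕ) →
  take ((sum (A ++ M) ∸ β) ∸ (sum A + α)) (drop (sum A + α) (wordFrom e (A ++ M ++ C)))
    ≡ seg α β (wordFrom (startAfter e A) M)
window e A M C α β = begin
  take ((sum (A ++ M) ∸ β) ∸ (sum A + α)) (drop (sum A + α) (wordFrom e (A ++ M ++ C)))
    ≡⟨ cong₂ (λ k v → take k (drop (sum A + α) v)) count
             (trans (wordFrom-++ e A (M ++ C)) (cong (U ++_) (wordFrom-++ e′ M C))) ⟩
  take (length X ∸ α ∸ β) (drop (sum A + α) (U ++ X ++ V))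
    ≡⟨ cong (λ n → take (length X ∸ α ∸ β) (drop (n + α) (U ++ X ++ V))) (length-wordFrom e A) ⟨
  take (length X ∸ α ∸ β) (drop (length U + α) (U ++ X ++ V))
    ≡⟨ cong (take (length X ∸ α ∸ β)) (drop-length-++ U (X ++ V) α) ⟩
  take (length X ∸ α ∸ β) (drop α (X ++ V))
    ≡⟨ seg-++ˡ α β X V ⟩
  seg α β X ∎
  where
  e′ = startAfter e A
  U  = wordFrom e A
  X  = wordFrom e′ M
  V  = wordFrom (startAfter e′ M) C
  a  = sum A
  m  = sum M
  count : (sum (A ++ M) ∸ β) ∸ (a + α) ≡ length X ∸ α ∸ β
  count = begin
    (sum (A ++ M) ∸ β) ∸ (a + α) ≡⟨ cong (λ n → (n ∸ β) ∸ (a + α)) (sum-++ A M) ⟩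
    (a + m ∸ β) ∸ (a + α)       ≡⟨ ∸-+-assoc (a + m) β (a + α) ⟩
    a + m ∸ (β + (a + α))       ≡⟨ cong (a + m ∸_) (+-comm β (a + α)) ⟩
    a + m ∸ ((a + α) + β)       ≡⟨ cong (a + m ∸_) (+-assoc a α β) ⟩
    a + m ∸ (a + (α + β))       ≡⟨ [m+n]∸[m+o]≡n∸o a m (α + β) ⟩
    m ∸ (α + β)                 ≡⟨ ∸-+-assoc m α β ⟨
    m ∸ α ∸ β                   ≡⟨ cong (λ n → n ∸ α ∸ β) (length-wordFrom e′ M) ⟨
    length X ∸ α ∸ β            ∎

subword-middle : (e : Letter) (A M C : List ℕ) (s t α β : ℕ) →
  length A ≡ s → length (A ++ M) ≡ suc t →
  subword (subseq (bd e (A ++ M ++ C)) s t α β) ≡ seg α β (wordFrom (startAfter e A) M)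
subword-middle e A M C s t α β refl |A++M|≡1+t = begin
  subword (subseq (bd e (A ++ M ++ C)) (length A) t α β)
    ≡⟨ cong₂ (λ pre upto → take ((sum upto ∸ β) ∸ (sum pre + α)) (drop (sum pre + α) (wordFrom e (A ++ M ++ C))))
             (take-length-++ A (M ++ C)) prefix-up-to-t ⟩
  take ((sum (A ++ M) ∸ β) ∸ (sum A + α)) (drop (sum A + α) (wordFrom e (A ++ M ++ C)))
    ≡⟨ window e A M C α β ⟩
  seg α β (wordFrom (startAfter e A) M) ∎
  where
  prefix-up-to-t : take (suc t) (A ++ M ++ C) ≡ A ++ M
  prefix-up-to-t = begin
    take (suc t) (A ++ M ++ C)                  ≡⟨ cong₂ take (sym |A++M|≡1+t) (sym (++-assoc A M C)) ⟩
    take (length (A ++ M)) ((A ++ M) ++ C)      ≡⟨ take-length-++ (A ++ M) C ⟩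
    A ++ M                                      ∎

lemma5p3 : (P : Subseq) → IsSubseq P →
    (subword (ρ P) ≡ reverse (subword P)) ⊎ (subword (ρ P) ≡ dual (subword P))
lemma5p3 (subseq (bd e ls) s t α β) (_ , s≤t , t<n , _) =
  subst₂ ReverseOrDual (sym reflected-window) (sym original-window)
    (seg-reverseOrDual α β (blocks-reversed (startAfter e A) M))
  where
  A = take s ls
  M = take (suc t ∸ s) (drop s ls)
  C = drop (suc t) ls
  |A|≡s : length A ≡ s
  |A|≡s = length-take-≤ s ls (≤-trans s≤t (<⇒≤ t<n))
  A++M≡prefix : A ++ M ≡ take (suc t) ls
  A++M≡prefix = trans (sym (take-+ s (suc t ∸ s) ls))
                      (cong (λ k → take k ls) (m+[n∸m]≡n (≤-trans s≤t (n≤1+n t))))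
  |A++M|≡1+t : length (A ++ M) ≡ suc t
  |A++M|≡1+t = trans (cong length A++M≡prefix) (length-take-≤ (suc t) ls t<n)
  |A++rM|≡1+t : length (A ++ reverse M) ≡ suc t
  |A++rM|≡1+t = trans (length-++ A) (trans (cong (length A +_) (length-reverse M))
                                           (trans (sym (length-++ A)) |A++M|≡1+t))
  ls≡AMC : ls ≡ A ++ M ++ C
  ls≡AMC = sym (trans (sym (++-assoc A M C))
                      (trans (cong (_++ C) A++M≡prefix) (take++drop≡id (suc t) ls)))
  original-window : subword (subseq (bd e ls) s t α β) ≡ seg α β (wordFrom (startAfter e A) M)
  original-window = subst (λ l → subword (subseq (bd e l) s t α β) ≡ seg α β (wordFrom (startAfter e A) M))
                          (sym ls≡AMC) (subword-middle e A M C s t α β |A|≡s |A++M|≡1+t)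
  reflected-window : subword (ρ (subseq (bd e ls) s t α β)) ≡ seg β α (wordFrom (startAfter e A) (reverse M))
  reflected-window = subword-middle e A (reverse M) C s t β α |A|≡s |A++rM|≡1+t
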